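{- For every $q$-matroid $\mathcal{M}=(\mathcal{E},\rho)$ on $\mathcal{E}=\mathbb{F}_q^n$, the pair $Cl(\mathcal{M})=(P(\mathcal{E}),\mathbf{r}_\rho)$ is a matroid.
   Context: A $q$-matroid is a pair $(\mathcal{E},\rho)$ with $\rho$ a function from the set of $\mathbb{F}_q$-subspaces of $\mathcal{E}$ to $\mathbb{N}_0$ such that $0\le\rho(X)\le\dim X$, $\rho(X)\le\rho(Y)$ for $X\subseteq Y$, and $\rho(X+Y)+\rho(X\cap Y)\le\rho(X)+\rho(Y)$. $P(\mathcal{E})$ is the set of $1$-dimensional subspaces of $\mathcal{E}$, and for $S\subseteq P(\mathcal{E})$, $\mathbf{r}_\rho(S)=\rho(\langle S\rangle)$ with $\langle S\rangle$ the subspace spanned by the elements of $S$. A matroid is a pair $(E,\mathbf{r})$, $E$ finite, $\mathbf{r}:2^E\to\mathbb{N}_0$ with $0\le\mathbf{r}(X)\le|X|$, $\mathbf{r}$ monotone, and $\mathbf{r}(X\cap Y)+\mathbf{r}(X\cup Y)\le\mathbf{r}(X)+\mathbf{r}(Y)$. -}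

module Defs where

open import Level using (Level; 0ℓ; _⊔_) renaming (suc to lsuc)
open import Algebra.Bundles using (CommutativeRing)
open import Data.Nat as ℕ using (ℕ; zero; suc)
open import Data.Fin using (Fin; zero; suc)
open import Data.Product using (Σ; ∃; _×_; _,_; proj₁; proj₂)
open import Data.Sum using (_⊎_; inj₁; inj₂)
open import Data.Empty using (⊥-elim)
open import Function using (_∘_)
open import Relation.Nullary using (¬_; Dec; yes; no)
open import Relation.Binary.Bundles using (Setoid)
open import Relation.Binary.PropositionalEquality using (_≡_)

-- Every finite field
-- is some F_q, so quantifying over these is quantifying over all F_q.

module _ (R : CommutativeRing 0ℓ 0ℓ) where
  open CommutativeRing R hiding (zero)

  record IsFiniteField : Set where
    field
      1≉0      : ¬ (1# ≈ 0#)
      inverse  : ∀ x → ¬ (x ≈ 0#) → ∃ λ y → x * y ≈ 1#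
      _≟_      : ∀ x y → Dec (x ≈ y)
      size     : ℕ
      enum     : Fin size → Carrier
      enum-onto : ∀ x → ∃ λ i → enum i ≈ x

module _ {a ℓ : Level} (E : Setoid a ℓ) where
  open Setoid E renaming (Carrier to El)

  record Subset : Set (a ⊔ ℓ ⊔ lsuc 0ℓ) where
    field
      mem  : El → Set
      resp : ∀ {x y} → x ≈ y → mem x → mem y
  open Subset public

  _⊆ₛ_ : Subset → Subset → Set a
  S ⊆ₛ T = ∀ x → mem S x → mem T x

  _∩ₛ_ : Subset → Subset → Subset
  S ∩ₛ T = record { mem = λ x → mem S x × mem T x
                  ; resp = λ e p → resp S e (proj₁ p) , resp T e (proj₂ p) }

  _∪ₛ_ : Subset → Subset → Subset
  S ∪ₛ T = record { mem = λ x → mem S x ⊎ mem T x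
                  ; resp = λ { e (inj₁ p) → inj₁ (resp S e p)
                             ; e (inj₂ p) → inj₂ (resp T e p) } }

  HasCard : Subset → ℕ → Set (a ⊔ ℓ)
  HasCard S k = Σ (Fin k → El) λ f →
                  (∀ i → mem S (f i))
                × (∀ i j → f i ≈ f j → i ≡ j)
                × (∀ x → mem S x → ∃ λ i → f i ≈ x)

  IsFinite : Set (a ⊔ ℓ)
  IsFinite = Σ ℕ λ k → Σ (Fin k → El) λ f → ∀ x → ∃ λ i → f i ≈ x

  record IsMatroid (r : Subset → ℕ) : Set (lsuc 0ℓ ⊔ a ⊔ ℓ) where
    field
      finite    : IsFinite
      r-bounded : ∀ S k → HasCard S k → r S ℕ.≤ k
      r-mono    : ∀ S T → S ⊆ₛ T → r S ℕ.≤ r T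
      r-submod  : ∀ S T → r (S ∩ₛ T) ℕ.+ r (S ∪ₛ T) ℕ.≤ r S ℕ.+ r T

module QMat (R : CommutativeRing 0ℓ 0ℓ) (F : IsFiniteField R) (n : ℕ) where
  open CommutativeRing R hiding (zero)
  open IsFiniteField F

  V : Set
  V = Fin n → Carrier

  _≈ᵥ_ : V → V → Set
  u ≈ᵥ v = ∀ j → u j ≈ v j

  0ᵥ : V
  0ᵥ _ = 0#

  _+ᵥ_ : V → V → V
  (u +ᵥ v) j = u j + v j

  _·_ : Carrier → V → V
  (a · u) j = a * u j

  infixl 6 _+ᵥ_
  infixr 7 _·_
  infix 4 _≈ᵥ_

  record Subspace : Set₁ where
    field
      _∋_     : V → Set
      ∋-resp  : ∀ {u v} → u ≈ᵥ v → _∋_ u → _∋_ v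
      ∋-0     : _∋_ 0ᵥ
      ∋-+     : ∀ {u v} → _∋_ u → _∋_ v → _∋_ (u +ᵥ v)
      ∋-·     : ∀ a {u} → _∋_ u → _∋_ (a · u)
  open Subspace public

  _⊆_ : Subspace → Subspace → Set
  X ⊆ Y = ∀ v → X ∋ v → Y ∋ v

  lincomb : ∀ {k} → (Fin k → Carrier) → (Fin k → V) → V
  lincomb {zero}  c b = 0ᵥ
  lincomb {suc k} c b = c zero · b zero +ᵥ lincomb (c ∘ suc) (b ∘ suc)

  LinIndep : ∀ {k} → (Fin k → V) → Set
  LinIndep b = ∀ c → lincomb c b ≈ᵥ 0ᵥ → ∀ i → c i ≈ 0#

  HasDim : Subspace → ℕ → Set
  HasDim X d = Σ (Fin d → V) λ b →
                 (∀ i → X ∋ b i)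
               × LinIndep b
               × (∀ v → X ∋ v → ∃ λ c → lincomb c b ≈ᵥ v)

  private
    ≈ᵥ-trans : ∀ {u v w} → u ≈ᵥ v → v ≈ᵥ w → u ≈ᵥ w
    ≈ᵥ-trans p q j = trans (p j) (q j)
    ≈ᵥ-sym : ∀ {u v} → u ≈ᵥ v → v ≈ᵥ u
    ≈ᵥ-sym p j = sym (p j)

    swap4 : ∀ a b c d → (a + b) + (c + d) ≈ (a + c) + (b + d)
    swap4 a b c d =
      trans (+-assoc a b (c + d))
      (trans (+-cong refl (sym (+-assoc b c d)))
      (trans (+-cong refl (+-cong (+-comm b c) refl))
      (trans (+-cong refl (+-assoc c b d))
      (sym (+-assoc a c (b + d))))))

  _⊕_ : Subspace → Subspace → Subspace
  X ⊕ Y = record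
    { _∋_    = λ v → Σ V λ x → Σ V λ y → X ∋ x × Y ∋ y × (v ≈ᵥ x +ᵥ y)
    ; ∋-resp = λ { e (x , y , px , py , q) → x , y , px , py , ≈ᵥ-trans (≈ᵥ-sym e) q }
    ; ∋-0    = 0ᵥ , 0ᵥ , ∋-0 X , ∋-0 Y , (λ j → sym (+-identityˡ 0#))
    ; ∋-+    = λ { (x , y , px , py , q) (x' , y' , px' , py' , q') →
                   x +ᵥ x' , y +ᵥ y' , ∋-+ X px px' , ∋-+ Y py py'
                   , (λ j → trans (+-cong (q j) (q' j)) (swap4 (x j) (y j) (x' j) (y' j))) }
    ; ∋-·    = λ { a (x , y , px , py , q) →
                   a · x , a · y , ∋-· X a px , ∋-· Y a py
                   , (λ j → trans (*-cong refl (q j)) (distribˡ a (x j) (y j))) }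
    }

  _⊓_ : Subspace → Subspace → Subspace
  X ⊓ Y = record
    { _∋_    = λ v → X ∋ v × Y ∋ v
    ; ∋-resp = λ e p → ∋-resp X e (proj₁ p) , ∋-resp Y e (proj₂ p)
    ; ∋-0    = ∋-0 X , ∋-0 Y
    ; ∋-+    = λ p q → ∋-+ X (proj₁ p) (proj₁ q) , ∋-+ Y (proj₂ p) (proj₂ q)
    ; ∋-·    = λ a p → ∋-· X a (proj₁ p) , ∋-· Y a (proj₂ p)
    }

  record QMatroid : Set₁ where
    field
      ρ        : Subspace → ℕ
      ρ-bounded : ∀ X d → HasDim X d → ρ X ℕ.≤ d
      ρ-mono   : ∀ X Y → X ⊆ Y → ρ X ℕ.≤ ρ Y
      ρ-submod : ∀ X Y → ρ (X ⊕ Y) ℕ.+ ρ (X ⊓ Y) ℕ.≤ ρ X ℕ.+ ρ Y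

  record Point : Set₁ where
    field
      sub  : Subspace
      dim1 : HasDim sub 1
  open Point public

  _≐_ : Point → Point → Set
  p ≐ p' = ∀ v → (sub p ∋ v → sub p' ∋ v) × (sub p' ∋ v → sub p ∋ v)

  PE : Setoid (lsuc 0ℓ) 0ℓ
  PE = record
    { Carrier = Point
    ; _≈_ = _≐_
    ; isEquivalence = record
      { refl  = λ v → (λ x → x) , (λ x → x)
      ; sym   = λ e v → proj₂ (e v) , proj₁ (e v)
      ; trans = λ e f v → (λ x → proj₁ (f v) (proj₁ (e v) x))
                        , (λ x → proj₂ (e v) (proj₂ (f v) x)) }
    }

  line : V → Subspace
  line u = record
    { _∋_    = λ v → ∃ λ a → a · u ≈ᵥ v
    ; ∋-resp = λ { e (a , q) → a , ≈ᵥ-trans q e }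
    ; ∋-0    = 0# , (λ j → zeroˡ (u j))
    ; ∋-+    = λ { (a , q) (b , q') → a + b
                 , (λ j → trans (distribʳ (u j) a b) (+-cong (q j) (q' j))) }
    ; ∋-·    = λ { b (a , q) → b * a
                 , (λ j → trans (*-assoc b a (u j)) (*-cong refl (q j))) }
    }

  private
    lc1 : ∀ (c : Fin 1 → Carrier) u → lincomb c (λ _ → u) ≈ᵥ c zero · u
    lc1 c u j = +-identityʳ (c zero * u j)

  pt : (u : V) → ¬ (u ≈ᵥ 0ᵥ) → Point
  pt u nz = record
    { sub  = line u
    ; dim1 = (λ _ → u)
           , (λ _ → 1# , (λ j → *-identityˡ (u j)))
           , indep
           , (λ { v (a , q) → (λ _ → a) , ≈ᵥ-trans (lc1 (λ _ → a) u) q })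
    }
    where
    indep : LinIndep {1} (λ _ → u)
    indep c e zero with c zero ≟ 0#
    ... | yes z = z
    ... | no nz' with inverse (c zero) nz'
    ...   | y , cy≈1 = ⊥-elim (nz (λ j →
              trans (sym (*-identityˡ (u j)))
              (trans (*-cong (sym (trans (*-comm y (c zero)) cy≈1)) refl)
              (trans (*-assoc y (c zero) (u j))
              (trans (*-cong refl (trans (sym (lc1 c u j)) (e j)))
              (zeroʳ y))))))

  -- ⟨S⟩ for S ⊆ P(E): the span of all vectors lying on some point of S.
  -- A nonzero u lies on a point p ∈ S iff the point ⟨u⟩ is in S
  -- (S respects equality of points), so the generators are the nonzero
  -- vectors u with pt u ∈ S.
  InUnion : Subset PE → V → Set
  InUnion S u = Σ (¬ (u ≈ᵥ 0ᵥ)) λ nz → Subset.mem S (pt u nz)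

  private
    appendF : ∀ {A : Set} {k m} → (Fin k → A) → (Fin m → A) → Fin (k ℕ.+ m) → A
    appendF {k = zero}  f g i       = g i
    appendF {k = suc k} f g zero    = f zero
    appendF {k = suc k} f g (suc i) = appendF (f ∘ suc) g i

    appendF-all : ∀ {A : Set} {P : A → Set} {k m} (f : Fin k → A) (g : Fin m → A) →
                  (∀ i → P (f i)) → (∀ i → P (g i)) → ∀ i → P (appendF f g i)
    appendF-all {k = zero}  f g pf pg i       = pg i
    appendF-all {k = suc k} f g pf pg zero    = pf zero
    appendF-all {P = P} {k = suc k} f g pf pg (suc i) = appendF-all {P = P} (f ∘ suc) g (pf ∘ suc) pg i

    lc-append : ∀ {k m} (c : Fin k → Carrier) (b : Fin k → V)
                (c' : Fin m → Carrier) (b' : Fin m → V) →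
                lincomb (appendF c c') (appendF b b') ≈ᵥ lincomb c b +ᵥ lincomb c' b'
    lc-append {zero}  c b c' b' j = sym (+-identityˡ _)
    lc-append {suc k} c b c' b' j =
      trans (+-cong refl (lc-append (c ∘ suc) (b ∘ suc) c' b' j))
            (sym (+-assoc _ _ _))

    lc-scale : ∀ {k} a (c : Fin k → Carrier) (b : Fin k → V) →
               a · lincomb c b ≈ᵥ lincomb (λ i → a * c i) b
    lc-scale {zero}  a c b j = zeroʳ a
    lc-scale {suc k} a c b j =
      trans (distribˡ a _ _)
            (+-cong (sym (*-assoc a (c zero) (b zero j))) (lc-scale a (c ∘ suc) (b ∘ suc) j))

  ⟨_⟩ : Subset PE → Subspace
  ⟨ S ⟩ = record
    { _∋_    = λ v → Σ ℕ λ k → Σ (Fin k → V) λ u → Σ (Fin k → Carrier) λ c →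
                 (∀ i → InUnion S (u i)) × (lincomb c u ≈ᵥ v)
    ; ∋-resp = λ { e (k , u , c , p , q) → k , u , c , p , ≈ᵥ-trans q e }
    ; ∋-0    = 0 , (λ ()) , (λ ()) , (λ ()) , (λ j → refl)
    ; ∋-+    = λ { (k , u , c , p , q) (k' , u' , c' , p' , q') →
                   k ℕ.+ k' , appendF u u' , appendF c c'
                   , appendF-all {P = InUnion S} u u' p p'
                   , (λ j → trans (lc-append c u c' u' j) (+-cong (q j) (q' j))) }
    ; ∋-·    = λ { a (k , u , c , p , q) →
                   k , u , (λ i → a * c i) , p
                   , (λ j → trans (sym (lc-scale a c u j)) (*-cong refl (q j))) }
    }

  r[_] : QMatroid → Subset PE → ℕ
  r[ M ] S = QMatroid.ρ M ⟨ S ⟩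

{-# OPTIONS --safe #-}
module Submission where

-- The rank r_ρ(S) = ρ(⟨S⟩) inherits monotonicity and submodularity from ρ
-- because ⟨S ∩ T⟩ ⊆ ⟨S⟩ ∩ ⟨T⟩ and ⟨S ∪ T⟩ ⊆ ⟨S⟩ + ⟨T⟩.  It is bounded by |S|
-- because ⟨S⟩ is contained in the sum of the |S| lines of S, each of rank at
-- most 1, and ρ is subadditive.  P(E) is finite, being the image of the
-- finite set F_q^n under u ↦ ⟨u⟩.

open import Defs
open import Level using (Level; 0ℓ)
open import Algebra.Bundles using (CommutativeRing)
open import Data.Nat using (ℕ; zero; suc; _*_; _+_; _≤_)
open import Data.Nat.Properties using (≤-trans; m≤m+n; +-mono-≤; +-comm; module ≤-Reasoning)
open import Data.Fin using (Fin; zero; suc; remQuot; combine)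
open import Data.Fin.Properties using (remQuot-combine; all?)
open import Data.Vec.Functional using (_∷_; head; tail)
open import Data.Vec.Functional.Relation.Binary.Equality.Setoid using (≋-setoid)
open import Data.Product using (∃; _,_; proj₁; proj₂; uncurry)
import Data.Product as Product
open import Data.Product.Relation.Binary.Pointwise.NonDependent using (_×ₛ_)
open import Data.Sum using (inj₁; inj₂)
open import Data.Empty using (⊥-elim)
open import Function using (_∘_)
open import Function.Definitions using (Surjective)
open import Relation.Nullary using (¬_; yes; no)
open import Relation.Binary.Bundles using (Setoid)
open import Relation.Binary.PropositionalEquality as ≡ using (subst)

module _ {a ℓ b ℓ′ : Level} (A : Setoid a ℓ) (B : Setoid b ℓ′) where
  open Setoid A using () renaming (Carrier to A₀; _≈_ to _≈₁_)
  open Setoid B using () renaming (Carrier to B₀; _≈_ to _≈₂_)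

  IsFinite-image : (g : A₀ → B₀) → Surjective _≈₁_ _≈₂_ g → IsFinite A → IsFinite B
  IsFinite-image g g-onto (k , e , e-onto) = k , g ∘ e , onto
    where
    onto : ∀ y → ∃ λ i → g (e i) ≈₂ y
    onto y with x , g≈y ← g-onto y with i , eᵢ≈x ← e-onto x = i , g≈y eᵢ≈x

  IsFinite-× : IsFinite A → IsFinite B → IsFinite (A ×ₛ B)
  IsFinite-× (k , e , e-onto) (l , f , f-onto) =
    k * l , Product.map e f ∘ remQuot l , onto
    where
    onto : ∀ xy → ∃ λ i → Setoid._≈_ (A ×ₛ B) (Product.map e f (remQuot l i)) xy
    onto (x , y) with i , eᵢ≈x ← e-onto x with j , fⱼ≈y ← f-onto y =
      combine i j , subst (λ ij → Setoid._≈_ (A ×ₛ B) (Product.map e f ij) (x , y))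
                          (≡.sym (remQuot-combine i j)) (eᵢ≈x , fⱼ≈y)

module _ {a ℓ : Level} (A : Setoid a ℓ) where
  IsFinite-≋ : IsFinite A → ∀ m → IsFinite (≋-setoid A m)
  IsFinite-≋ finA zero    = 1 , (λ _ ()) , (λ v → zero , λ ())
  IsFinite-≋ finA (suc m) =
    IsFinite-image (A ×ₛ ≋-setoid A m) (≋-setoid A (suc m)) (uncurry _∷_)
      ∷-onto (IsFinite-× A (≋-setoid A m) finA (IsFinite-≋ finA m))
    where
    ∷-onto : Surjective (Setoid._≈_ (A ×ₛ ≋-setoid A m)) (Setoid._≈_ (≋-setoid A (suc m)))
                        (uncurry _∷_)
    ∷-onto v = (head v , tail v) , λ { (x≈ , w≋) → λ { zero → x≈ ; (suc t) → w≋ t } }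

module Spans (R : CommutativeRing 0ℓ 0ℓ) (F : IsFiniteField R) (n : ℕ) where
  open QMat R F n
  open CommutativeRing R hiding (zero)

  lincomb∈ : (W : Subspace) → ∀ {k} (c : Fin k → Carrier) (u : Fin k → V) →
             (∀ i → W ∋ u i) → W ∋ lincomb c u
  lincomb∈ W {zero}  c u u∈W = ∋-0 W
  lincomb∈ W {suc k} c u u∈W =
    ∋-+ W (∋-· W (c zero) (u∈W zero)) (lincomb∈ W (c ∘ suc) (u ∘ suc) (u∈W ∘ suc))

  generator∈⟨⟩ : ∀ S u → InUnion S u → ⟨ S ⟩ ∋ u
  generator∈⟨⟩ S u u∈S = 1 , (λ _ → u) , (λ _ → 1#) , (λ _ → u∈S) ,
                         (λ j → trans (+-identityʳ _) (*-identityˡ _))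

  ⟨⟩-least : ∀ S (W : Subspace) → (∀ u → InUnion S u → W ∋ u) → ⟨ S ⟩ ⊆ W
  ⟨⟩-least S W S⊆W v (k , u , c , u∈S , c·u≈v) =
    ∋-resp W c·u≈v (lincomb∈ W c u (λ i → S⊆W (u i) (u∈S i)))

  ⟨⟩-mono : ∀ S T → _⊆ₛ_ PE S T → ⟨ S ⟩ ⊆ ⟨ T ⟩
  ⟨⟩-mono S T S⊆T = ⟨⟩-least S ⟨ T ⟩ (λ u u∈S → generator∈⟨⟩ T u (proj₁ u∈S , S⊆T _ (proj₂ u∈S)))

  ⟨∩ₛ⟩⊆⟨⟩⊓⟨⟩ : ∀ S T → ⟨ _∩ₛ_ PE S T ⟩ ⊆ (⟨ S ⟩ ⊓ ⟨ T ⟩)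
  ⟨∩ₛ⟩⊆⟨⟩⊓⟨⟩ S T = ⟨⟩-least (_∩ₛ_ PE S T) (⟨ S ⟩ ⊓ ⟨ T ⟩)
    λ { u (u≉0 , u∈S , u∈T) → generator∈⟨⟩ S u (u≉0 , u∈S) , generator∈⟨⟩ T u (u≉0 , u∈T) }

  ⟨∪ₛ⟩⊆⟨⟩⊕⟨⟩ : ∀ S T → ⟨ _∪ₛ_ PE S T ⟩ ⊆ (⟨ S ⟩ ⊕ ⟨ T ⟩)
  ⟨∪ₛ⟩⊆⟨⟩⊕⟨⟩ S T = ⟨⟩-least (_∪ₛ_ PE S T) (⟨ S ⟩ ⊕ ⟨ T ⟩) u∈⟨S⟩⊕⟨T⟩
    where
    u∈⟨S⟩⊕⟨T⟩ : ∀ u → InUnion (_∪ₛ_ PE S T) u → (⟨ S ⟩ ⊕ ⟨ T ⟩) ∋ u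
    u∈⟨S⟩⊕⟨T⟩ u (u≉0 , inj₁ u∈S) =
      u , 0ᵥ , generator∈⟨⟩ S u (u≉0 , u∈S) , ∋-0 ⟨ T ⟩ , (λ j → sym (+-identityʳ _))
    u∈⟨S⟩⊕⟨T⟩ u (u≉0 , inj₂ u∈T) =
      0ᵥ , u , ∋-0 ⟨ S ⟩ , generator∈⟨⟩ T u (u≉0 , u∈T) , (λ j → sym (+-identityˡ _))

  𝟎 : Subspace
  𝟎 = record
    { _∋_    = λ v → v ≈ᵥ 0ᵥ
    ; ∋-resp = λ u≈v u≈0 j → trans (sym (u≈v j)) (u≈0 j)
    ; ∋-0    = λ j → refl
    ; ∋-+    = λ u≈0 v≈0 j → trans (+-cong (u≈0 j) (v≈0 j)) (+-identityˡ _)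
    ; ∋-·    = λ a u≈0 j → trans (*-cong refl (u≈0 j)) (zeroʳ a)
    }

  dim𝟎≡0 : HasDim 𝟎 0
  dim𝟎≡0 = (λ ()) , (λ ()) , (λ _ _ ()) , (λ v v≈0 → (λ ()) , (λ j → sym (v≈0 j)))

  ⨁ : ∀ {k} → (Fin k → Point) → Subspace
  ⨁ {zero}  p = 𝟎
  ⨁ {suc k} p = sub (p zero) ⊕ ⨁ (p ∘ suc)

  sub⊆⨁ : ∀ {k} (p : Fin k → Point) i → sub (p i) ⊆ ⨁ p
  sub⊆⨁ p zero    v v∈p = v , 0ᵥ , v∈p , ∋-0 (⨁ (p ∘ suc)) , (λ j → sym (+-identityʳ _))
  sub⊆⨁ p (suc i) v v∈p = 0ᵥ , v , ∋-0 (sub (p zero)) , sub⊆⨁ (p ∘ suc) i v v∈p ,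
                          (λ j → sym (+-identityˡ _))

  ⟨⟩⊆⨁ : ∀ S {k} (p : Fin k → Point) → (∀ x → mem S x → ∃ λ i → _≐_ (p i) x) → ⟨ S ⟩ ⊆ ⨁ p
  ⟨⟩⊆⨁ S p p-onto = ⟨⟩-least S (⨁ p) u∈⨁p
    where
    u∈⨁p : ∀ u → InUnion S u → ⨁ p ∋ u
    u∈⨁p u (u≉0 , ⟨u⟩∈S) with i , pᵢ≐⟨u⟩ ← p-onto (pt u u≉0) ⟨u⟩∈S =
      sub⊆⨁ p i u (proj₂ (pᵢ≐⟨u⟩ u) (1# , (λ j → *-identityˡ _)))

module Points (R : CommutativeRing 0ℓ 0ℓ) (F : IsFiniteField R) (n : ℕ) where
  open QMat R F n
  open CommutativeRing R hiding (zero)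
  open IsFiniteField F

  spanningVector : Point → V
  spanningVector p = proj₁ (dim1 p) zero

  spanningVector≉0 : ∀ p → ¬ (spanningVector p ≈ᵥ 0ᵥ)
  spanningVector≉0 p b≈0 = 1≉0 (proj₁ (proj₂ (proj₂ (dim1 p))) (λ _ → 1#) 1·b≈0 zero)
    where
    1·b≈0 : lincomb (λ _ → 1#) (proj₁ (dim1 p)) ≈ᵥ 0ᵥ
    1·b≈0 j = trans (+-identityʳ _) (trans (*-identityˡ _) (b≈0 j))

  pt≐ : ∀ p u (u≉0 : ¬ (u ≈ᵥ 0ᵥ)) → u ≈ᵥ spanningVector p → _≐_ (pt u u≉0) p
  pt≐ p u u≉0 u≈b v = ⟨u⟩⊆p , p⊆⟨u⟩
    where
    ⟨u⟩⊆p : ∃ (λ a → a · u ≈ᵥ v) → sub p ∋ v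
    ⟨u⟩⊆p (a , a·u≈v) = ∋-resp (sub p) (λ j → trans (*-cong refl (sym (u≈b j))) (a·u≈v j))
                          (∋-· (sub p) a (proj₁ (proj₂ (dim1 p)) zero))
    p⊆⟨u⟩ : sub p ∋ v → ∃ (λ a → a · u ≈ᵥ v)
    p⊆⟨u⟩ v∈p with c , c·b≈v ← proj₂ (proj₂ (proj₂ (dim1 p))) v v∈p =
      c zero , (λ j → trans (*-cong refl (u≈b j)) (trans (sym (+-identityʳ _)) (c·b≈v j)))

  -- The zero vector, which spans no line, is sent to an arbitrary point p₀.
  lineOr : Point → V → Point
  lineOr p₀ u with all? (λ j → u j ≟ 0#)
  ... | yes _   = p₀
  ... | no u≉0 = pt u u≉0

  lineOr-surjective : ∀ p₀ → Surjective _≈ᵥ_ _≐_ (lineOr p₀)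
  lineOr-surjective p₀ p = spanningVector p , ⟨u⟩≐p
    where
    ⟨u⟩≐p : ∀ {u} → u ≈ᵥ spanningVector p → _≐_ (lineOr p₀ u) p
    ⟨u⟩≐p {u} u≈b with all? (λ j → u j ≟ 0#)
    ... | yes u≈0 = ⊥-elim (spanningVector≉0 p (λ j → trans (sym (u≈b j)) (u≈0 j)))
    ... | no u≉0  = pt≐ p u u≉0 u≈b

  IsFinite-PE : Point → IsFinite PE
  IsFinite-PE p₀ = IsFinite-image (≋-setoid setoid n) PE (lineOr p₀) (lineOr-surjective p₀)
                     (IsFinite-≋ setoid (size , enum , enum-onto) n)

PE-finite : ∀ R F n → IsFinite (QMat.PE R F n)
PE-finite R F zero    = 0 , (λ ()) , λ p → ⊥-elim (Points.spanningVector≉0 R F 0 p (λ ()))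
PE-finite R F (suc n) = Points.IsFinite-PE R F (suc n) (QMat.pt R F (suc n) e₀ e₀≉0)
  where
  open CommutativeRing R using (0#; 1#)
  e₀ : QMat.V R F (suc n)
  e₀ = 1# ∷ λ _ → 0#
  e₀≉0 : ¬ QMat._≈ᵥ_ R F (suc n) e₀ (QMat.0ᵥ R F (suc n))
  e₀≉0 e₀≈0 = IsFiniteField.1≉0 F (e₀≈0 zero)

module ClMatroid (R : CommutativeRing 0ℓ 0ℓ) (F : IsFiniteField R) (n : ℕ)
                 (M : QMat.QMatroid R F n) where
  open QMat R F n
  open QMatroid M
  open Spans R F n

  ρ-⊕≤ : ∀ X Y → ρ (X ⊕ Y) ≤ ρ X + ρ Y
  ρ-⊕≤ X Y = ≤-trans (m≤m+n _ _) (ρ-submod X Y)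

  ρ-⨁≤ : ∀ {k} (p : Fin k → Point) → ρ (⨁ p) ≤ k
  ρ-⨁≤ {zero}  p = ρ-bounded 𝟎 0 dim𝟎≡0
  ρ-⨁≤ {suc k} p = ≤-trans (ρ-⊕≤ _ _)
    (+-mono-≤ (ρ-bounded (sub (p zero)) 1 (dim1 (p zero))) (ρ-⨁≤ (p ∘ suc)))

  r-bounded : ∀ S k → HasCard PE S k → r[ M ] S ≤ k
  r-bounded S k (p , _ , _ , p-onto) = ≤-trans (ρ-mono _ _ (⟨⟩⊆⨁ S p p-onto)) (ρ-⨁≤ p)

  r-mono : ∀ S T → _⊆ₛ_ PE S T → r[ M ] S ≤ r[ M ] T
  r-mono S T S⊆T = ρ-mono _ _ (⟨⟩-mono S T S⊆T)

  r-submod : ∀ S T → r[ M ] (_∩ₛ_ PE S T) + r[ M ] (_∪ₛ_ PE S T) ≤ r[ M ] S + r[ M ] T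
  r-submod S T = begin
    ρ ⟨ _∩ₛ_ PE S T ⟩ + ρ ⟨ _∪ₛ_ PE S T ⟩ ≤⟨ +-mono-≤ (ρ-mono _ _ (⟨∩ₛ⟩⊆⟨⟩⊓⟨⟩ S T))
                                                     (ρ-mono _ _ (⟨∪ₛ⟩⊆⟨⟩⊕⟨⟩ S T)) ⟩
    ρ (⟨ S ⟩ ⊓ ⟨ T ⟩) + ρ (⟨ S ⟩ ⊕ ⟨ T ⟩) ≡⟨ +-comm (ρ (⟨ S ⟩ ⊓ ⟨ T ⟩)) _ ⟩
    ρ (⟨ S ⟩ ⊕ ⟨ T ⟩) + ρ (⟨ S ⟩ ⊓ ⟨ T ⟩) ≤⟨ ρ-submod ⟨ S ⟩ ⟨ T ⟩ ⟩
    ρ ⟨ S ⟩ + ρ ⟨ T ⟩                    ∎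
    where open ≤-Reasoning

proposition2p15 : (R : CommutativeRing 0ℓ 0ℓ) (F : IsFiniteField R) (n : ℕ)
                  (M : QMat.QMatroid R F n) →
                  IsMatroid (QMat.PE R F n) (QMat.r[_] R F n M)
proposition2p15 R F n M = record
  { finite    = PE-finite R F n
  ; r-bounded = r-bounded
  ; r-mono    = r-mono
  ; r-submod  = r-submod
  }
  where open ClMatroid R F n M
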